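{- Let $G=(V_1\cup V_2,E)$ be a bipartite graph with parts $V_1,V_2$, $|V_1|=|V_2|=3$, and $d(v)\le 2$ for all $v\in V_2$. If the maximum size of a matching in $G$ is at most two, then $G$ is a subgraph of one of the following three bipartite graphs on the same vertex set with the same parts $V_1,V_2$ (i.e., for some $j\in\{1,2,3\}$ there is a bijection of $V_1\cup V_2$ onto the vertex set of $G_j$ mapping $V_1$ to the first part and $V_2$ to the second part and mapping edges of $G$ to edges of $G_j$): (1) $G_1$: a copy of $K_{2,3}$ whose part of size two lies in $V_1$ and whose part of size three is $V_2$ (the remaining vertex of $V_1$ is isolated); (2) $G_2$: two vertex-disjoint paths with two edges each (necessarily one with its middle vertex in $V_1$ and the other with its middle vertex in $V_2$); (3) $G_3$: a path with four edges whose two endpoints lie in $V_1$ (so it uses all three vertices of $V_1$ and two vertices of $V_2$).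
   Context: $d(v)$ denotes the degree of vertex $v$ in $G$. A matching is a set of pairwise disjoint edges. -}

module Defs where

open import Data.Nat using (ℕ; zero; suc; _+_)
open import Data.Bool using (Bool; true; false; if_then_else_)
open import Data.Fin using (Fin; zero; suc)
open import Data.Product using (Σ; _×_; _,_; ∃-syntax)
open import Data.Sum using (_⊎_)
open import Function.Bundles using (_↔_; Inverse)
open import Function.Definitions using (Injective)
open import Relation.Binary.PropositionalEquality using (_≡_)
open import Relation.Nullary using (¬_)

-- A bipartite graph with parts V₁ = Fin 3 and V₂ = Fin 3:
-- E u v = true iff u ∈ V₁ is adjacent to v ∈ V₂.
BipGraph : Set
BipGraph = Fin 3 → Fin 3 → Bool

deg₂ : BipGraph → Fin 3 → ℕ
deg₂ E v = b2n (E zero v) + (b2n (E (suc zero) v) + b2n (E (suc (suc zero)) v))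
  where
  b2n : Bool → ℕ
  b2n true  = 1
  b2n false = 0

record Matching (E : BipGraph) (k : ℕ) : Set where
  field
    f    : Fin k → Fin 3
    g    : Fin k → Fin 3
    f-inj : Injective _≡_ _≡_ f
    g-inj : Injective _≡_ _≡_ g
    edge : ∀ i → E (f i) (g i) ≡ true

-- maximum matching size at most 2: no matching with 3 edges
-- (any larger matching contains one with 3 edges; here max possible is 3)
MaxMatchingAtMost2 : BipGraph → Set
MaxMatchingAtMost2 E = ¬ Matching E 3

SubgraphUpToIso : BipGraph → BipGraph → Set
SubgraphUpToIso E H =
  Σ (Fin 3 ↔ Fin 3) λ σ → Σ (Fin 3 ↔ Fin 3) λ τ →
    ∀ u v → E u v ≡ true → H (Inverse.to σ u) (Inverse.to τ v) ≡ true

G₁ : BipGraph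
G₁ zero          _ = true
G₁ (suc zero)    _ = true
G₁ (suc (suc _)) _ = false

-- G₂: paths b0 - a0 - b1  and  a1 - b2 - a2
G₂ : BipGraph
G₂ zero zero = true
G₂ zero (suc zero) = true
G₂ (suc zero) (suc (suc zero)) = true
G₂ (suc (suc zero)) (suc (suc zero)) = true
G₂ _ _ = false

-- G₃: path a0 - b0 - a1 - b1 - a2
G₃ : BipGraph
G₃ zero zero = true
G₃ (suc zero) zero = true
G₃ (suc zero) (suc zero) = true
G₃ (suc (suc zero)) (suc zero) = true
G₃ _ _ = false

module Submission where

-- There are only 2⁹ such graphs, and each one carries a certificate that can be checked by
-- computation: a vertex of V₂ of degree 3, a perfect matching u ↦ σ u for a permutation σ,
-- or a pair of permutations of V₁ and V₂ embedding it into G₁, G₂ or G₃. Deciding a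
-- statement about all functions Fin 3 → Fin 3 → Bool needs its invariance under pointwise
-- equality, so the search runs over 3 × 3 Boolean matrices and is transferred back.

open import Defs
open import Data.Bool using (Bool; true; false)
open import Data.Bool.Properties using (_≟_)
open import Data.Empty using (⊥-elim)
open import Data.Fin using (Fin)
open import Data.Fin.Patterns using (0F; 1F; 2F)
open import Data.Fin.Permutation using (Permutation′; _⟨$⟩ʳ_; id; transpose; _∘ₚ_)
open import Data.Fin.Properties using (all?)
open import Data.List using (List; []; _∷_; cartesianProduct)
open import Data.List.Relation.Unary.Any using (Any; any?; satisfied)
open import Data.Nat using (ℕ; zero; suc; _≤_; _≤?_)
open import Data.Product using (_×_; _,_)
open import Data.Sum using (_⊎_; inj₁; inj₂)
import Data.Sum as Sum
open import Data.Vec using (Vec; []; _∷_; lookup; tabulate)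
open import Data.Vec.Properties using (lookup∘tabulate)
open import Function using (_∘_)
open import Function.Bundles using (Injection)
open import Function.Properties.Inverse using (↔⇒↣)
open import Relation.Binary.PropositionalEquality using (_≡_; sym; trans; cong; cong₂; subst)
open import Relation.Nullary using (Dec; ¬_; ¬?; _×-dec_; _⊎-dec_; _→-dec_)
open import Relation.Nullary.Decidable using (map′; from-yes)
open import Relation.Unary using (Decidable)

Exhaustive : Set → Set₁
Exhaustive A = ∀ {P : A → Set} → Decidable P → Dec (∀ x → P x)

exhaustive-Bool : Exhaustive Bool
exhaustive-Bool P? = map′ both (λ h → h true , h false) (P? true ×-dec P? false)
  where
  both : ∀ {P : Bool → Set} → P true × P false → ∀ b → P b
  both (p , _) true  = p
  both (_ , p) false = p

exhaustive-Vec : ∀ {A} → Exhaustive A → ∀ n → Exhaustive (Vec A n)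
exhaustive-Vec _ zero P? = map′ (λ { p [] → p }) (λ h → h []) (P? [])
exhaustive-Vec A-exhaustive (suc n) P? =
  map′ (λ { h (x ∷ xs) → h x xs }) (λ h x xs → h (x ∷ xs))
       (A-exhaustive λ x → exhaustive-Vec A-exhaustive n λ xs → P? (x ∷ xs))

_≗₂_ : BipGraph → BipGraph → Set
E ≗₂ E′ = ∀ u v → E u v ≡ E′ u v

Matrix : Set
Matrix = Vec (Vec Bool 3) 3

toMatrix : BipGraph → Matrix
toMatrix E = tabulate (tabulate ∘ E)

fromMatrix : Matrix → BipGraph
fromMatrix M u v = lookup (lookup M u) v

fromMatrix-toMatrix : ∀ E → fromMatrix (toMatrix E) ≗₂ E
fromMatrix-toMatrix E u v =
  trans (cong (λ row → lookup row v) (lookup∘tabulate (tabulate ∘ E) u)) (lookup∘tabulate (E u) v)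

-- deg₂ E v unfolds to columnDegree (E 0F v) (E 1F v) (E 2F v); this avoids function extensionality.
columnDegree : Bool → Bool → Bool → ℕ
columnDegree a b c = deg₂ (λ u _ → lookup (a ∷ b ∷ c ∷ []) u) 0F

deg₂-resp : ∀ {E E′} → E ≗₂ E′ → ∀ v → deg₂ E v ≡ deg₂ E′ v
deg₂-resp eq v =
  cong₂ (λ a (b , c) → columnDegree a b c) (eq 0F v) (cong₂ _,_ (eq 1F v) (eq 2F v))

Matching-resp : ∀ {E E′ k} → E ≗₂ E′ → Matching E k → Matching E′ k
Matching-resp eq m = record
  { f = f ; g = g ; f-inj = f-inj ; g-inj = g-inj
  ; edge = λ i → trans (sym (eq (f i) (g i))) (edge i) }
  where open Matching m

SubgraphUpToIso-resp : ∀ {E E′ H} → E ≗₂ E′ → SubgraphUpToIso E H → SubgraphUpToIso E′ H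
SubgraphUpToIso-resp eq (σ , τ , sub) = σ , τ , λ u v e → sub u v (trans (eq u v) e)

permutations₃ : List (Permutation′ 3)
permutations₃ =
  id ∷ transpose 0F 1F ∷ transpose 0F 2F ∷ transpose 1F 2F ∷
  transpose 0F 1F ∘ₚ transpose 1F 2F ∷ transpose 1F 2F ∘ₚ transpose 0F 1F ∷ []

permutationPairs₃ : List (Permutation′ 3 × Permutation′ 3)
permutationPairs₃ = cartesianProduct permutations₃ permutations₃

PerfectMatchingVia : BipGraph → Permutation′ 3 → Set
PerfectMatchingVia E σ = ∀ u → E u (σ ⟨$⟩ʳ u) ≡ true

perfectMatchingVia? : ∀ E → Decidable (PerfectMatchingVia E)
perfectMatchingVia? E σ = all? λ u → E u (σ ⟨$⟩ʳ u) ≟ true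

perfectMatchingVia⇒Matching : ∀ {E} σ → PerfectMatchingVia E σ → Matching E 3
perfectMatchingVia⇒Matching σ perfect = record
  { f = λ u → u ; g = σ ⟨$⟩ʳ_ ; f-inj = λ e → e
  ; g-inj = Injection.injective (↔⇒↣ σ) ; edge = perfect }

EmbeddingVia : BipGraph → BipGraph → Permutation′ 3 × Permutation′ 3 → Set
EmbeddingVia E H (σ , τ) = ∀ u v → E u v ≡ true → H (σ ⟨$⟩ʳ u) (τ ⟨$⟩ʳ v) ≡ true

embeddingVia? : ∀ E H → Decidable (EmbeddingVia E H)
embeddingVia? E H (σ , τ) = all? λ u → all? λ v → E u v ≟ true →-dec H (σ ⟨$⟩ʳ u) (τ ⟨$⟩ʳ v) ≟ true

Embeds : BipGraph → BipGraph → Set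
Embeds E H = Any (EmbeddingVia E H) permutationPairs₃

embeds? : ∀ E H → Dec (Embeds E H)
embeds? E H = any? {P = EmbeddingVia E H} (embeddingVia? E H) permutationPairs₃

Embeds⇒SubgraphUpToIso : ∀ {E H} → Embeds E H → SubgraphUpToIso E H
Embeds⇒SubgraphUpToIso embeds with satisfied embeds
... | (σ , τ) , sub = σ , τ , sub

Deg₂≤2 : BipGraph → Set
Deg₂≤2 E = ∀ v → deg₂ E v ≤ 2

deg₂≤2? : ∀ E → Dec (Deg₂≤2 E)
deg₂≤2? E = all? λ v → deg₂ E v ≤? 2

SubgraphOfSomeGⱼ : BipGraph → Set
SubgraphOfSomeGⱼ E = SubgraphUpToIso E G₁ ⊎ (SubgraphUpToIso E G₂ ⊎ SubgraphUpToIso E G₃)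

Outcome : BipGraph → Set
Outcome E = ¬ Deg₂≤2 E ⊎ (Matching E 3 ⊎ SubgraphOfSomeGⱼ E)

Outcome-resp : ∀ {E E′} → E ≗₂ E′ → Outcome E → Outcome E′
Outcome-resp eq =
  Sum.map (λ unbounded bounded → unbounded λ v → subst (_≤ 2) (sym (deg₂-resp eq v)) (bounded v))
    (Sum.map (Matching-resp eq)
      (Sum.map (SubgraphUpToIso-resp {H = G₁} eq)
        (Sum.map (SubgraphUpToIso-resp {H = G₂} eq) (SubgraphUpToIso-resp {H = G₃} eq))))

Certified : BipGraph → Set
Certified E =
  ¬ Deg₂≤2 E ⊎ (Any (PerfectMatchingVia E) permutations₃ ⊎ (Embeds E G₁ ⊎ (Embeds E G₂ ⊎ Embeds E G₃)))

certified? : ∀ E → Dec (Certified E)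
certified? E = ¬? (deg₂≤2? E) ⊎-dec any? (perfectMatchingVia? E) permutations₃
  ⊎-dec embeds? E G₁ ⊎-dec embeds? E G₂ ⊎-dec embeds? E G₃

Certified⇒Outcome : ∀ {E} → Certified E → Outcome E
Certified⇒Outcome (inj₁ unbounded) = inj₁ unbounded
Certified⇒Outcome (inj₂ (inj₁ perfect)) with satisfied perfect
... | σ , matched = inj₂ (inj₁ (perfectMatchingVia⇒Matching σ matched))
Certified⇒Outcome (inj₂ (inj₂ embeds)) =
  inj₂ (inj₂ (Sum.map (Embeds⇒SubgraphUpToIso {H = G₁})
    (Sum.map (Embeds⇒SubgraphUpToIso {H = G₂}) (Embeds⇒SubgraphUpToIso {H = G₃})) embeds))

every-matrix-certified : ∀ M → Certified (fromMatrix M)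
every-matrix-certified = from-yes (exhaustive-Vec (exhaustive-Vec exhaustive-Bool 3) 3 (certified? ∘ fromMatrix))

outcome : ∀ E → Outcome E
outcome E = Outcome-resp (fromMatrix-toMatrix E) (Certified⇒Outcome (every-matrix-certified (toMatrix E)))

lemma2 : (E : BipGraph) → (∀ (v : Fin 3) → deg₂ E v ≤ 2) → MaxMatchingAtMost2 E →
    SubgraphUpToIso E G₁ ⊎ (SubgraphUpToIso E G₂ ⊎ SubgraphUpToIso E G₃)
lemma2 E bounded noPerfectMatching = resolve (outcome E)
  where
  resolve : Outcome E → SubgraphOfSomeGⱼ E
  resolve (inj₁ unbounded) = ⊥-elim (unbounded bounded)
  resolve (inj₂ (inj₁ perfect)) = ⊥-elim (noPerfectMatching perfect)
  resolve (inj₂ (inj₂ subgraph)) = subgraph
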